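{- If $Q=mK^2$ for some $m\mid M$ with $\mathrm{gcd}(m,M/m)=1$, then \[ -W_Q(x,-y,-z,w)\cdot W_Q(x,y,z,w)^{ -1}\in \Gamma_0(MK^2)\cap \Gamma_1(K). \] In other words, the Atkin--Lehner operator $w_Q(x,y,z,w)$ (the operator induced by the matrix $W_Q(x,y,z,w)$) satisfies $Jw_Q(x,y,z,w)J=w_Q(x,y,z,w)$.
   Context: $K,M$ are coprime positive integers and we work at level $L:=MK^2$. For $Q\mid L$ with $\mathrm{gcd}(Q,L/Q)=1$, the Atkin--Lehner matrices at level $L$ are $W_Q(x,y,z,w):=\begin{pmatrix} Qx & y \\ Lz & Qw\end{pmatrix}$ with $x,y,z,w\in\mathbb{Z}$ chosen so that $\det W_Q(x,y,z,w)=Q$. Here $J=\begin{pmatrix} -1 & 0\\ 0 & 1\end{pmatrix}$, and $\Gamma_0(MK^2)\cap\Gamma_1(K)$ is the congruence subgroup of $\mathrm{SL}_2(\mathbb{Z})$ of matrices that are upper triangular mod $MK^2$ and congruent to $\begin{pmatrix} 1&*\\0&1\end{pmatrix}$ mod $K$. Matrices act as operators on cusp forms / homology of the corresponding modular curve, with $\pm$ scalars acting trivially. -}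

module Defs where

open import Data.Nat as ℕ using (ℕ)
open import Data.Integer using (ℤ; +_; _+_; _-_; _*_; -_)
open import Data.Integer.Divisibility using (_∣_)
open import Data.Product using (_×_)
open import Relation.Binary.PropositionalEquality using (_≡_)

record Mat2 : Set where
  constructor mat
  field
    a b c d : ℤ
open Mat2 public

_⊗_ : Mat2 → Mat2 → Mat2
mat a₁ b₁ c₁ d₁ ⊗ mat a₂ b₂ c₂ d₂ =
  mat (a₁ * a₂ + b₁ * c₂) (a₁ * b₂ + b₁ * d₂)
      (c₁ * a₂ + d₁ * c₂) (c₁ * b₂ + d₁ * d₂)

negM : Mat2 → Mat2
negM (mat a b c d) = mat (- a) (- b) (- c) (- d)

det : Mat2 → ℤ
det (mat a b c d) = a * d - b * c

level : ℕ → ℕ → ℕ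
level M K = M ℕ.* (K ℕ.* K)

W : (Q L : ℕ) → (x y z w : ℤ) → Mat2
W Q L x y z w = mat (+ Q * x) y (+ L * z) (+ Q * w)

InΓ₀Γ₁ : (N K : ℕ) → Mat2 → Set
InΓ₀Γ₁ N K γ =
  det γ ≡ + 1 × (+ N ∣ c γ) × (+ K ∣ (a γ - + 1)) × (+ K ∣ (d γ - + 1))

{-# OPTIONS --safe #-}
-- Put Δ = Qxw − m′yz, so that det W_Q(x,y,z,w) = QΔ and the determinant condition says Δ = 1.
-- Multiplying −W_Q(x,−y,−z,w) by the adjugate of W_Q(x,y,z,w) and dividing by Q gives the
-- integral matrix γ = ( t , 2xy ; 2Lzw , t ) with t = −(Qxw + m′yz), and γ W_Q(x,y,z,w) is
-- −Δ W_Q(x,−y,−z,w). Moreover det γ = t² − 4Qm′xyzw = Δ², the entry 2Lzw is a multiple of L,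
-- and t − 1 = t − Δ = −2Qxw is a multiple of K because K ∣ Q.
module Submission where

open import Defs
open import Data.Nat using (ℕ; _<_)
open import Data.Nat.Coprimality using (Coprime)
open import Data.Integer using (ℤ; +_; -_)
open import Data.Product using (Σ; _×_)
open import Relation.Binary.PropositionalEquality using (_≡_)

open import Data.Integer using (_+_; _-_; _*_; ∣_∣; NonZero)
open import Data.Integer.Divisibility using (_∣_)
open import Data.Integer.Properties using (abs-*; pos-*; *-identityˡ; *-identityʳ; *-cancelˡ-≡)
open import Data.Integer.Tactic.RingSolver using (solve)
import Data.Nat as ℕ
import Data.Nat.Divisibility as ℕ
import Data.Nat.Properties as ℕ
open import Data.Nat.Tactic.RingSolver using (solve-∀)
open import Data.List using (_∷_; [])
open import Data.Product using (_,_)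
open import Relation.Binary.PropositionalEquality
  using (refl; sym; trans; cong; subst; module ≡-Reasoning)

∣m⇒∣m*n : ∀ k m n → k ∣ m → k ∣ m * n
∣m⇒∣m*n k m n k∣m = subst (ℕ._∣_ ∣ k ∣) (sym (abs-* m n)) (ℕ.∣m⇒∣m*n ∣ n ∣ k∣m)

mat-cong : ∀ {a b c d a′ b′ c′ d′} →
           a ≡ a′ → b ≡ b′ → c ≡ c′ → d ≡ d′ → mat a b c d ≡ mat a′ b′ c′ d′
mat-cong refl refl refl refl = refl

scale : ℤ → Mat2 → Mat2
scale s (mat a b c d) = mat (s * a) (s * b) (s * c) (s * d)

scale-identity : ∀ A → scale (+ 1) A ≡ A
scale-identity (mat a b c d) =
  mat-cong (*-identityˡ a) (*-identityˡ b) (*-identityˡ c) (*-identityˡ d)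

-- W Q L x y z w is definitionally Wℤ (+ Q) (+ L) x y z w.
Wℤ : (q l x y z w : ℤ) → Mat2
Wℤ q l x y z w = mat (q * x) y (l * z) (q * w)

reducedDet : (q n x y z w : ℤ) → ℤ
reducedDet q n x y z w = q * x * w - n * y * z

det-Wℤ : ∀ q n x y z w → det (Wℤ q (q * n) x y z w) ≡ q * reducedDet q n x y z w
det-Wℤ q n x y z w = identity
  where
  identity : q * x * (q * w) - y * (q * n * z) ≡ q * (q * x * w - n * y * z)
  identity = solve (q ∷ n ∷ x ∷ y ∷ z ∷ w ∷ [])

reducedDet≡1 : ∀ q n x y z w .{{_ : NonZero q}} →
               det (Wℤ q (q * n) x y z w) ≡ q → reducedDet q n x y z w ≡ + 1
reducedDet≡1 q n x y z w detW≡q = *-cancelˡ-≡ q _ (+ 1) (begin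
  q * reducedDet q n x y z w   ≡⟨ sym (det-Wℤ q n x y z w) ⟩
  det (Wℤ q (q * n) x y z w)   ≡⟨ detW≡q ⟩
  q                            ≡⟨ sym (*-identityʳ q) ⟩
  q * + 1                      ∎)
  where open ≡-Reasoning

jConjugator : (q n x y z w : ℤ) → Mat2
jConjugator q n x y z w = mat t (+ 2 * x * y) (q * n * (+ 2 * z * w)) t
  where t = - (q * x * w + n * y * z)

det-jConjugator : ∀ q n x y z w →
                  det (jConjugator q n x y z w) ≡ reducedDet q n x y z w * reducedDet q n x y z w
det-jConjugator q n x y z w = identity
  where
  identity : - (q * x * w + n * y * z) * - (q * x * w + n * y * z)
               - + 2 * x * y * (q * n * (+ 2 * z * w))
             ≡ (q * x * w - n * y * z) * (q * x * w - n * y * z)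
  identity = solve (q ∷ n ∷ x ∷ y ∷ z ∷ w ∷ [])

a-jConjugator : ∀ q n x y z w →
                a (jConjugator q n x y z w) - reducedDet q n x y z w ≡ q * - (+ 2 * x * w)
a-jConjugator q n x y z w = identity
  where
  identity : - (q * x * w + n * y * z) - (q * x * w - n * y * z) ≡ q * - (+ 2 * x * w)
  identity = solve (q ∷ n ∷ x ∷ y ∷ z ∷ w ∷ [])

jConjugator-⊗-Wℤ : ∀ q n x y z w →
                   jConjugator q n x y z w ⊗ Wℤ q (q * n) x y z w
                   ≡ scale (reducedDet q n x y z w) (negM (Wℤ q (q * n) x (- y) (- z) w))
jConjugator-⊗-Wℤ q n x y z w = mat-cong entry-a entry-b entry-c entry-d
  where
  entry-a : - (q * x * w + n * y * z) * (q * x) + + 2 * x * y * (q * n * z)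
            ≡ (q * x * w - n * y * z) * - (q * x)
  entry-a = solve (q ∷ n ∷ x ∷ y ∷ z ∷ w ∷ [])
  entry-b : - (q * x * w + n * y * z) * y + + 2 * x * y * (q * w)
            ≡ (q * x * w - n * y * z) * - (- y)
  entry-b = solve (q ∷ n ∷ x ∷ y ∷ z ∷ w ∷ [])
  entry-c : q * n * (+ 2 * z * w) * (q * x) + - (q * x * w + n * y * z) * (q * n * z)
            ≡ (q * x * w - n * y * z) * - (q * n * - z)
  entry-c = solve (q ∷ n ∷ x ∷ y ∷ z ∷ w ∷ [])
  entry-d : q * n * (+ 2 * z * w) * y + - (q * x * w + n * y * z) * (q * w)
            ≡ (q * x * w - n * y * z) * - (q * w)
  entry-d = solve (q ∷ n ∷ x ∷ y ∷ z ∷ w ∷ [])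

jConjugation : ∀ (N K : ℕ) q n x y z w .{{_ : NonZero q}} → + N ≡ q * n → + K ∣ q →
               det (Wℤ q (+ N) x y z w) ≡ q →
               Σ Mat2 (λ γ → InΓ₀Γ₁ N K γ ×
                 γ ⊗ Wℤ q (+ N) x y z w ≡ negM (Wℤ q (+ N) x (- y) (- z) w))
jConjugation N K q n x y z w N≡qn K∣q detW≡q =
  γ , (det-γ≡1 , N∣c , K∣a-1 , K∣a-1) , subst γW≡-W⁻ (sym N≡qn) γW₀≡-W₀⁻
  where
  γ = jConjugator q n x y z w
  Δ = reducedDet q n x y z w

  Δ≡1 : Δ ≡ + 1
  Δ≡1 = reducedDet≡1 q n x y z w (subst (λ l → det (Wℤ q l x y z w) ≡ q) N≡qn detW≡q)

  det-γ≡1 : det γ ≡ + 1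
  det-γ≡1 = trans (det-jConjugator q n x y z w) (cong (λ s → s * s) Δ≡1)

  N∣c : + N ∣ c γ
  N∣c = ∣m⇒∣m*n (+ N) (q * n) (+ 2 * z * w) (subst (+ N ∣_) N≡qn (ℕ.∣-refl {N}))

  K∣a-1 : + K ∣ a γ - + 1
  K∣a-1 = subst (λ s → + K ∣ a γ - s) Δ≡1
    (subst (+ K ∣_) (sym (a-jConjugator q n x y z w)) (∣m⇒∣m*n (+ K) q _ K∣q))

  γW≡-W⁻ : ℤ → Set
  γW≡-W⁻ l = γ ⊗ Wℤ q l x y z w ≡ negM (Wℤ q l x (- y) (- z) w)

  γW₀≡-W₀⁻ : γW≡-W⁻ (q * n)
  γW₀≡-W₀⁻ = begin
    γ ⊗ Wℤ q (q * n) x y z w                             ≡⟨ jConjugator-⊗-Wℤ q n x y z w ⟩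
    scale Δ (negM (Wℤ q (q * n) x (- y) (- z) w))       ≡⟨ cong (λ s → scale s _) Δ≡1 ⟩
    scale (+ 1) (negM (Wℤ q (q * n) x (- y) (- z) w))   ≡⟨ scale-identity _ ⟩
    negM (Wℤ q (q * n) x (- y) (- z) w)                 ∎
    where open ≡-Reasoning

mainTheorem9 : (K M : ℕ) → 0 < K → 0 < M → Coprime K M →
    (m m′ : ℕ) → Data.Nat._*_ m m′ ≡ M → Coprime m m′ →
    (x y z w : ℤ) →
    det (W (Data.Nat._*_ m (Data.Nat._*_ K K)) (level M K) x y z w) ≡ + (Data.Nat._*_ m (Data.Nat._*_ K K)) →
    Σ Mat2 (λ γ → InΓ₀Γ₁ (level M K) K γ ×
      (γ ⊗ W (Data.Nat._*_ m (Data.Nat._*_ K K)) (level M K) x y z w)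
        ≡ negM (W (Data.Nat._*_ m (Data.Nat._*_ K K)) (level M K) x (- y) (- z) w))
mainTheorem9 K M 0<K 0<M _ m m′ refl _ x y z w detW≡Q =
  jConjugation (level M K) K (+ Q) (+ m′) x y z w {{Q≢0}} L≡Qm′ K∣Q detW≡Q
  where
  Q = m ℕ.* (K ℕ.* K)

  Q≢0 : ℕ.NonZero Q
  Q≢0 = ℕ.m*n≢0 m (K ℕ.* K) {{ℕ.m*n≢0⇒m≢0 m {{ℕ.>-nonZero 0<M}}}} {{K²≢0}}
    where K²≢0 = ℕ.m*n≢0 K K {{ℕ.>-nonZero 0<K}} {{ℕ.>-nonZero 0<K}}

  L≡Qm′ : + level M K ≡ + Q * + m′
  L≡Qm′ = trans (cong +_ (*-rightComm m m′ (K ℕ.* K))) (pos-* Q m′)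
    where
    *-rightComm : ∀ i j k → i ℕ.* j ℕ.* k ≡ i ℕ.* k ℕ.* j
    *-rightComm = solve-∀

  K∣Q : + K ∣ + Q
  K∣Q = ℕ.∣n⇒∣m*n m (ℕ.m∣m*n K)
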